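{- For a quasi-order $Q$ the following are equivalent: (1) $Q$ is a better-quasi-order; (2) there is no bad super-sequence in $Q$; (3) there is no bad spare super-sequence in $Q$.
   Context: For $u,v\subseteq\omega$, $u\sqsubseteq v$ means $u=v$ or $u=\{k\in v\mid k<n\}$ for some $n\in v$; $u\sqsubset v$ means $u\sqsubseteq v$, $u\neq v$. A front on an infinite $X\subseteq\omega$ is a family $F$ of finite subsets of $\omega$ with (i) $F=\{\emptyset\}$ or $\bigcup F=X$; (ii) $s,t\in F$, $s\sqsubseteq t\Rightarrow s=t$; (iii) every infinite $X'\subseteq X$ has some $s\in F$ with $s\sqsubset X'$. A super-sequence is a map $f:F\to Q$ from a front. For finite $s,t$, $s\triangleleft t$ means there is an infinite $X$ with $s\sqsubset X$ and $t\sqsubset X\setminus\{\min X\}$; $f$ is bad if $s\triangleleft t$ in $F$ implies $f(s)\not\leq f(t)$. For $f:F\to Q$ with $F$ a front on $X$, define $f^{\uparrow}:[X]^{\omega}\to Q$ by $f^{\uparrow}(Y)=f(s)$ for the unique $s\in F$ with $s\sqsubset Y$; $f$ is spare if $F$ equals the set of $\sqsubseteq$-minimal finite $s\subseteq X$ such that $f^{\uparrow}$ is constant on $\{Y\in[X]^{\omega}\mid s\sqsubset Y\}$. $Q$ is a better-quasi-order if there is no locally constant $h:[\omega]^{\omega}\to Q$ with $h(N)\not\leq h(N\setminus\{\min N\})$ for all $N$, where $[\omega]^{\omega}$ (infinite subsets of $\omega$) has the Cantor-space topology and locally constant means: for every $Y$ there is $s\sqsubset Y$ with $h$ constant on $\{Z\mid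 s\sqsubset Z\}$. -}

module Defs where

open import Data.Nat using (ℕ; suc; _<_; _<?_)
open import Data.List using (List; []; map; upTo; filter)
open import Data.List.Membership.Propositional using (_∈_)
open import Data.List.Relation.Unary.Linked using (Linked)
open import Data.Product using (Σ; ∃; _×_; _,_; proj₁; proj₂)
open import Data.Sum using (_⊎_)
open import Function using (_∘_)
open import Function.Bundles using (_⇔_)
open import Relation.Binary.PropositionalEquality using (_≡_; _≢_)
open import Relation.Binary.Structures using (IsPreorder)
open import Relation.Nullary using (¬_; Dec)

-- Finite subsets of ω are represented by lists of naturals; the members
-- of a front are required to be strictly increasing lists (so that a
-- list is a canonical description of a finite set).

FinSet : Set
FinSet = List ℕ

Increasing : FinSet → Set
Increasing = Linked _<_

_⊑_ : FinSet → FinSet → Set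
u ⊑ v = u ≡ v ⊎ Σ ℕ (λ n → n ∈ v × u ≡ filter (_<? n) v)

_⊏_ : FinSet → FinSet → Set
u ⊏ v = u ⊑ v × u ≢ v

-- Infinite subsets of ω, represented by their strictly increasing
-- enumerations.

Inf : Set
Inf = Σ (ℕ → ℕ) (λ g → ∀ i → g i < g (suc i))

_∈ω_ : ℕ → Inf → Set
n ∈ω Y = Σ ℕ (λ i → proj₁ Y i ≡ n)

_⊆ω_ : Inf → Inf → Set
Y ⊆ω X = ∀ n → n ∈ω Y → n ∈ω X

prefix : Inf → ℕ → FinSet
prefix Y m = map (proj₁ Y) (upTo m)

-- s ⊏ Y  :⇔  s = {k ∈ Y | k < n} for some n ∈ Y  (n = Y m)
_⊏ω_ : FinSet → Inf → Set
s ⊏ω Y = Σ ℕ (λ m → s ≡ prefix Y m)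

tailω : Inf → Inf
tailω (g , p) = (g ∘ suc) , (p ∘ suc)

record Front (X : Inf) (F : FinSet → Set) : Set₁ where
  field
    finite     : ∀ s → F s → Increasing s
    union      : (∀ s → F s ⇔ s ≡ [])
                 ⊎ (∀ n → Σ FinSet (λ s → F s × n ∈ s) ⇔ n ∈ω X)
    antichain  : ∀ s t → F s → F t → s ⊑ t → s ≡ t
    barrier    : ∀ X' → X' ⊆ω X → Σ FinSet (λ s → F s × s ⊏ω X')

_◁_ : FinSet → FinSet → Set
s ◁ t = Σ Inf (λ X → s ⊏ω X × t ⊏ω tailω X)

module _ {Q : Set} (_≤_ : Q → Q → Set) where

  -- a super-sequence is f : F → Q, here a map on the members of F
  Bad : (F : FinSet → Set) → ((s : FinSet) → F s → Q) → Set
  Bad F f = ∀ s t (p : F s) (q : F t) → s ◁ t → ¬ (f s p ≤ f t q)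

  -- f↑ is constant on {Y ∈ [X]^ω | s ⊏ Y}, where f↑(Y) = f(t) for the
  -- (unique) t ∈ F with t ⊏ Y
  UpConst : (X : Inf) (F : FinSet → Set) → ((s : FinSet) → F s → Q)
          → FinSet → Set
  UpConst X F f s =
    Σ Q (λ c → ∀ (Y : Inf) t (p : F t) → Y ⊆ω X → s ⊏ω Y → t ⊏ω Y → f t p ≡ c)

  MinConst : (X : Inf) (F : FinSet → Set) → ((s : FinSet) → F s → Q)
           → FinSet → Set
  MinConst X F f s =
    Increasing s × (∀ n → n ∈ s → n ∈ω X) × UpConst X F f s
    × (∀ u → u ⊏ s → ¬ UpConst X F f u)

  Spare : (X : Inf) (F : FinSet → Set) → ((s : FinSet) → F s → Q) → Set
  Spare X F f = ∀ s → F s ⇔ MinConst X F f s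

  NoBad : Set₁
  NoBad = ¬ Σ Inf (λ X → Σ (FinSet → Set) (λ F → Σ ((s : FinSet) → F s → Q)
            (λ f → Front X F × Bad F f)))

  NoBadSpare : Set₁
  NoBadSpare = ¬ Σ Inf (λ X → Σ (FinSet → Set) (λ F → Σ ((s : FinSet) → F s → Q)
            (λ f → Front X F × Spare X F f × Bad F f)))

  LocallyConstant : (Inf → Q) → Set
  LocallyConstant h = ∀ Y → Σ FinSet (λ s → s ⊏ω Y ×
    (∀ Z Z' → s ⊏ω Z → s ⊏ω Z' → h Z ≡ h Z'))

  IsBQO : Set
  IsBQO = ¬ Σ (Inf → Q) (λ h → LocallyConstant h × (∀ N → ¬ (h N ≤ h (tailω N))))

-- A locally constant bad h : [ω]^ω → Q becomes a bad spare super-sequence on the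
-- front of ⊑-minimal finite sets whose cone is h-constant; conversely a bad
-- super-sequence f on a front on X yields the bad locally constant map
-- N ↦ f↑(X[N]), where X[N] = {X n | n ∈ N}.
module Submission where

open import Defs
open import Data.Product using (_×_)
open import Function.Bundles using (_⇔_)
open import Relation.Binary.PropositionalEquality using (_≡_)
open import Relation.Binary.Structures using (IsPreorder)
open import Relation.Nullary using (Dec)

open import Data.Empty using (⊥-elim)
open import Data.List using ([]; _∷_; map; upTo; applyUpTo; filter; length)
open import Data.List.Membership.Propositional using (_∈_)
open import Data.List.Membership.Propositional.Properties using (∈-applyUpTo⁺; ∈-applyUpTo⁻)
open import Data.List.Properties using (map-upTo; map-∘; filter-accept; filter-reject; filter-none; ≡-dec)
open import Data.List.Relation.Unary.All.Properties using (applyUpTo⁺₂)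
open import Data.List.Relation.Unary.Any using (here)
import Data.List.Relation.Unary.Linked as Linked
import Data.List.Relation.Unary.Linked.Properties as Linkedₚ
open import Data.Nat using (ℕ; zero; suc; _+_; _≤_; _<_; _<?_; _≟_; s≤s; z<s; s<s)
open import Data.Nat.Properties using (<-trans; <-irrefl; <-asym; n<1+n; m≤m+n; m≤n⇒m<n∨m≡n; m<1+n⇒m<n∨m≡n; ≤-total; +-identityʳ; +-monoʳ-<)
open import Data.Product using (Σ; _,_; proj₁; proj₂)
open import Data.Sum using (_⊎_; inj₁; inj₂)
open import Function using (_∘_; id)
open import Function.Bundles using (mk⇔; module Equivalence)
open import Relation.Binary.PropositionalEquality using (refl; sym; trans; cong; subst; subst₂; module ≡-Reasoning)
open import Relation.Nullary using (¬_; yes; no)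
open import Relation.Nullary.Decidable using (recompute)
open import Relation.Binary.Definitions using (Reflexive)

enum-<-mono : ∀ (Y : Inf) {i j} → i < j → proj₁ Y i < proj₁ Y j
enum-<-mono Y {i} {suc j} (s≤s i≤j) with m≤n⇒m<n∨m≡n i≤j
... | inj₁ i<j  = <-trans (enum-<-mono Y i<j) (proj₂ Y j)
... | inj₂ refl = proj₂ Y i

prefix≡applyUpTo : ∀ (Y : Inf) k → prefix Y k ≡ applyUpTo (proj₁ Y) k
prefix≡applyUpTo Y = map-upTo (proj₁ Y)

filter-<-applyUpTo : ∀ (Y : Inf) {j k} → j < k →
                     filter (_<? proj₁ Y j) (applyUpTo (proj₁ Y) k) ≡ applyUpTo (proj₁ Y) j
filter-<-applyUpTo Y {zero} {suc k} _ =
  trans (filter-reject (_<? proj₁ Y 0) (<-irrefl refl))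
        (filter-none (_<? proj₁ Y 0)
          (applyUpTo⁺₂ (proj₁ Y ∘ suc) k λ i → <-asym (enum-<-mono Y z<s)))
filter-<-applyUpTo Y {suc j} {suc k} (s<s j<k) =
  trans (filter-accept (_<? proj₁ Y (suc j)) (enum-<-mono Y z<s))
        (cong (proj₁ Y 0 ∷_) (filter-<-applyUpTo (tailω Y) j<k))

filter-<-prefix : ∀ (Y : Inf) {j k} → j < k → filter (_<? proj₁ Y j) (prefix Y k) ≡ prefix Y j
filter-<-prefix Y {j} {k} j<k
  rewrite prefix≡applyUpTo Y k | prefix≡applyUpTo Y j = filter-<-applyUpTo Y j<k

∈-prefix⁻ : ∀ (Y : Inf) {n} k → n ∈ prefix Y k → Σ ℕ λ j → j < k × n ≡ proj₁ Y j
∈-prefix⁻ Y {n} k n∈ = ∈-applyUpTo⁻ (proj₁ Y) (subst (n ∈_) (prefix≡applyUpTo Y k) n∈)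

prefix-increasing : ∀ (Y : Inf) k → Increasing (prefix Y k)
prefix-increasing Y k =
  subst Increasing (sym (prefix≡applyUpTo Y k)) (Linkedₚ.applyUpTo⁺₂ (proj₁ Y) k (proj₂ Y))

prefix-⊑ : ∀ (Y : Inf) {j k} → j ≤ k → prefix Y j ⊑ prefix Y k
prefix-⊑ Y {j} {k} j≤k with m≤n⇒m<n∨m≡n j≤k
... | inj₂ refl = inj₁ refl
... | inj₁ j<k  = inj₂ (proj₁ Y j , ∈Yk , sym (filter-<-prefix Y j<k))
  where
  ∈Yk : proj₁ Y j ∈ prefix Y k
  ∈Yk = subst (proj₁ Y j ∈_) (sym (prefix≡applyUpTo Y k)) (∈-applyUpTo⁺ (proj₁ Y) j<k)

⊏-prefix : ∀ (Y : Inf) {u k} → u ⊏ prefix Y k → Σ ℕ λ j → j < k × u ≡ prefix Y j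
⊏-prefix Y (inj₁ u≡ , u≢) = ⊥-elim (u≢ u≡)
⊏-prefix Y {k = k} (inj₂ (n , n∈ , u≡) , _) with ∈-prefix⁻ Y k n∈
... | j , j<k , refl = j , j<k , trans u≡ (filter-<-prefix Y j<k)

ω : Inf
ω = id , n<1+n

_∘ω_ : Inf → Inf → Inf
X ∘ω N = proj₁ X ∘ proj₁ N , λ i → enum-<-mono X (proj₂ N i)

∘ω-⊆ω : ∀ X N → (X ∘ω N) ⊆ω X
∘ω-⊆ω X N n (i , Xi≡n) = proj₁ N i , Xi≡n

prefix-∘ω : ∀ X N k → prefix (X ∘ω N) k ≡ map (proj₁ X) (prefix N k)
prefix-∘ω X N k = map-∘ (upTo k)

-- continue b s enumerates s followed by max s + 1, max s + 2, …  (b, b + 1, … if s = []).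
-- Extending s this way shows every increasing list is an initial segment of an infinite set.
continue : ℕ → FinSet → ℕ → ℕ
continue b []      i       = b + i
continue b (a ∷ s) zero    = a
continue b (a ∷ s) (suc i) = continue (suc a) s i

continue-strict : ∀ b s → Increasing s → ∀ i → continue b s i < continue b s (suc i)
continue-strict b []           _  i       = +-monoʳ-< b (n<1+n i)
continue-strict b (a ∷ [])     _  zero    = m≤m+n (suc a) 0
continue-strict b (a ∷ a' ∷ s) s↑ zero    = Linked.head s↑
continue-strict b (a ∷ s)      s↑ (suc i) = continue-strict (suc a) s (Linked.tail s↑) i

extension : (s : FinSet) → Increasing s → Inf
extension s s↑ = continue 0 s , continue-strict 0 s s↑

applyUpTo-continue : ∀ b s → applyUpTo (continue b s) (length s) ≡ s
applyUpTo-continue b []      = refl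
applyUpTo-continue b (a ∷ s) = cong (a ∷_) (applyUpTo-continue (suc a) s)

⊏ω-extension : ∀ s s↑ → s ⊏ω extension s s↑
⊏ω-extension s s↑ =
  length s , sym (trans (prefix≡applyUpTo (extension s s↑) _) (applyUpTo-continue 0 s))

Least : (ℕ → Set) → ℕ → Set
Least P k = P k × (∀ j → j < k → ¬ P j)

module _ {P : ℕ → Set} (P? : ∀ n → Dec (P n)) where

  private
    search : ∀ m → (∀ j → j < m → ¬ P j) ⊎ Σ ℕ (Least P)
    search zero = inj₁ λ _ ()
    search (suc m) with search m | P? m
    ... | inj₂ least   | _      = inj₂ least
    ... | inj₁ below   | yes Pm = inj₂ (m , Pm , below)
    ... | inj₁ below   | no ¬Pm = inj₁ λ j j<1+m → case (m<1+n⇒m<n∨m≡n j<1+m)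
      where
      case : ∀ {j} → j < m ⊎ j ≡ m → ¬ P j
      case (inj₁ j<m)  = below _ j<m
      case (inj₂ refl) = ¬Pm

  least : ∀ {m} → P m → Σ ℕ (Least P)
  least {m} Pm with search m
  ... | inj₁ below = m , Pm , below
  ... | inj₂ l     = l

module _ {X : Inf} {F : FinSet → Set} (front : Front X F) where

  open Front front

  ⊏ω-unique : ∀ {s t} Y → F s → F t → s ⊏ω Y → t ⊏ω Y → s ≡ t
  ⊏ω-unique Y Fs Ft (j , refl) (k , refl) with ≤-total j k
  ... | inj₁ j≤k = antichain _ _ Fs Ft (prefix-⊑ Y j≤k)
  ... | inj₂ k≤j = sym (antichain _ _ Ft Fs (prefix-⊑ Y k≤j))

ConeConstant : {Q : Set} → (Inf → Q) → FinSet → Set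
ConeConstant h s = ∀ Z Z' → s ⊏ω Z → s ⊏ω Z' → h Z ≡ h Z'

MinimalConeConstant : {Q : Set} → (Inf → Q) → FinSet → Set
MinimalConeConstant h s = Increasing s × ConeConstant h s × (∀ u → u ⊏ s → ¬ ConeConstant h u)

NoBad⇒NoBadSpare : {Q : Set} (_≼_ : Q → Q → Set) → NoBad _≼_ → NoBadSpare _≼_
NoBad⇒NoBadSpare _ noBad (X , F , f , front , _ , bad) = noBad (X , F , f , front , bad)

module _ {Q : Set} (_≼_ : Q → Q → Set) (em : (P : Set) → Dec P) where

  IsBQO⇒NoBad : IsBQO _≼_ → NoBad _≼_
  IsBQO⇒NoBad isBQO (X , F , f , front , bad) = isBQO (h , h-locallyConstant , h-bad)
    where
    open Front front

    -- Evaluating f at a recomputed proof makes it proof-irrelevant.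
    f̂ : ∀ s → .(F s) → Q
    f̂ s Fs = f s (recompute (em (F s)) Fs)

    f̂-cong : ∀ {s t} .{Fs : F s} .{Ft : F t} → s ≡ t → f̂ s Fs ≡ f̂ t Ft
    f̂-cong refl = refl

    member : ∀ N → Σ FinSet λ s → F s × s ⊏ω (X ∘ω N)
    member N = barrier (X ∘ω N) (∘ω-⊆ω X N)

    h : Inf → Q
    h N = f̂ (proj₁ (member N)) (proj₁ (proj₂ (member N)))

    h≡f̂ : ∀ {s} N → (Fs : F s) → s ⊏ω (X ∘ω N) → h N ≡ f̂ s Fs
    h≡f̂ N Fs s⊏ with member N
    ... | t , Ft , t⊏ = f̂-cong {Fs = Ft} {Ft = Fs} (⊏ω-unique front (X ∘ω N) Ft Fs t⊏ s⊏)

    h-bad : ∀ N → ¬ (h N ≼ h (tailω N))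
    h-bad N = bad _ _ _ _ (X ∘ω N , proj₂ (proj₂ (member N)) , proj₂ (proj₂ (member (tailω N))))

    h-locallyConstant : LocallyConstant _≼_ h
    h-locallyConstant Y with member Y
    ... | s , Fs , (m , s≡) =
      prefix Y m , (m , refl) , λ Z Z' Z⊐ Z'⊐ → trans (cone Z Z⊐) (sym (cone Z' Z'⊐))
      where
      cone : ∀ Z → prefix Y m ⊏ω Z → h Z ≡ f̂ s Fs
      cone Z (k , Yₘ≡Zₖ) = h≡f̂ Z Fs (k , (begin
        s                             ≡⟨ s≡ ⟩
        prefix (X ∘ω Y) m             ≡⟨ prefix-∘ω X Y m ⟩
        map (proj₁ X) (prefix Y m)    ≡⟨ cong (map (proj₁ X)) Yₘ≡Zₖ ⟩
        map (proj₁ X) (prefix Z k)    ≡⟨ sym (prefix-∘ω X Z k) ⟩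
        prefix (X ∘ω Z) k             ∎))
        where open ≡-Reasoning

  module _ (h : Inf → Q) (h-locallyConstant : LocallyConstant _≼_ h) where

    private
      F : FinSet → Set
      F = MinimalConeConstant h

    valueOnCone : (s : FinSet) → F s → Q
    valueOnCone s (s↑ , _) = h (extension s s↑)

    valueOnCone≡ : ∀ {s} (Fs : F s) Y → s ⊏ω Y → valueOnCone s Fs ≡ h Y
    valueOnCone≡ {s} (s↑ , const , _) Y s⊏Y = const _ Y (⊏ω-extension s s↑) s⊏Y

    -- Local constancy gives some prefix of Y with constant cone; take the shortest.
    minimalCone-⊏ω : ∀ Y → Σ FinSet λ s → F s × s ⊏ω Y
    minimalCone-⊏ω Y with h-locallyConstant Y
    ... | s , (m , s≡) , const
        with least (λ k → em (ConeConstant h (prefix Y k))) (subst (ConeConstant h) s≡ const)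
    ... | k , constₖ , below =
      prefix Y k , (prefix-increasing Y k , constₖ , minimal) , (k , refl)
      where
      minimal : ∀ u → u ⊏ prefix Y k → ¬ ConeConstant h u
      minimal u u⊏ with ⊏-prefix Y u⊏
      ... | j , j<k , refl = below j j<k

    minimalCone-antichain : ∀ s t → F s → F t → s ⊑ t → s ≡ t
    minimalCone-antichain s t Fs (_ , _ , minimalₜ) s⊑t with ≡-dec _≟_ s t
    ... | yes s≡t = s≡t
    ... | no  s≢t = ⊥-elim (minimalₜ s (s⊑t , s≢t) (proj₁ (proj₂ Fs)))

    coneConstant⇔upConst : ∀ u → ConeConstant h u ⇔ UpConst _≼_ ω F valueOnCone u
    coneConstant⇔upConst u = mk⇔ toUp fromUp
      where
      toUp : ConeConstant h u → UpConst _≼_ ω F valueOnCone u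
      toUp const with em (Σ Inf (u ⊏ω_))
      ... | yes (Y₀ , u⊏Y₀) =
        h Y₀ , λ Y t Ft _ u⊏Y t⊏Y → trans (valueOnCone≡ Ft Y t⊏Y) (const Y Y₀ u⊏Y u⊏Y₀)
      ... | no  noCone = h ω , λ Y _ _ _ u⊏Y _ → ⊥-elim (noCone (Y , u⊏Y))

      fromUp : UpConst _≼_ ω F valueOnCone u → ConeConstant h u
      fromUp (c , up) Z Z' u⊏Z u⊏Z' = trans (h≡c Z u⊏Z) (sym (h≡c Z' u⊏Z'))
        where
        h≡c : ∀ Z → u ⊏ω Z → h Z ≡ c
        h≡c Z u⊏Z with minimalCone-⊏ω Z
        ... | t , Ft , t⊏Z =
          trans (sym (valueOnCone≡ Ft Z t⊏Z)) (up Z t Ft (λ n _ → n , refl) u⊏Z t⊏Z)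

    minimalCone-spare : Spare _≼_ ω F valueOnCone
    minimalCone-spare s = mk⇔
      (λ (s↑ , const , minimal) →
         s↑ , (λ n _ → n , refl) , to const , λ u u⊏s → minimal u u⊏s ∘ from)
      (λ (s↑ , _ , up , minimal) → s↑ , from up , λ u u⊏s → minimal u u⊏s ∘ to)
      where
      to   = λ {u} → Equivalence.to   (coneConstant⇔upConst u)
      from = λ {u} → Equivalence.from (coneConstant⇔upConst u)

    -- n lies in the member of F below {n, n + 1, …}, which is not the empty set.
    minimalCone-front : ¬ ConeConstant h [] → Front ω F
    minimalCone-front ¬const[] = record
      { finite     = λ _ → proj₁
      ; union      = inj₂ λ n → mk⇔ (λ _ → n , refl) (λ _ → covers n)
      ; antichain  = minimalCone-antichain
      ; barrier    = λ Y _ → minimalCone-⊏ω Y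
      }
      where
      covers : ∀ n → Σ FinSet λ s → F s × n ∈ s
      covers n with minimalCone-⊏ω ((n +_) , λ i → +-monoʳ-< n (n<1+n i))
      ... | s , Fs , (zero  , refl) = ⊥-elim (¬const[] (proj₁ (proj₂ Fs)))
      ... | s , Fs , (suc m , refl) = s , Fs , here (sym (+-identityʳ n))

    minimalCone-bad : (∀ N → ¬ (h N ≼ h (tailω N))) → Bad _≼_ F valueOnCone
    minimalCone-bad h-bad s t Fs Ft (Y , s⊏Y , t⊏Y) =
      h-bad Y ∘ subst₂ _≼_ (valueOnCone≡ Fs Y s⊏Y) (valueOnCone≡ Ft (tailω Y) t⊏Y)

  NoBadSpare⇒IsBQO : Reflexive _≼_ → NoBadSpare _≼_ → IsBQO _≼_
  NoBadSpare⇒IsBQO ≼-refl noBadSpare (h , h-locallyConstant , h-bad) =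
    noBadSpare (ω , MinimalConeConstant h , valueOnCone h h-locallyConstant
               , minimalCone-front h h-locallyConstant ¬const[]
               , minimalCone-spare h h-locallyConstant
               , minimalCone-bad h h-locallyConstant h-bad)
    where
    ¬const[] : ¬ ConeConstant h []
    ¬const[] const = h-bad ω (subst (h ω ≼_) (const ω (tailω ω) (0 , refl) (0 , refl)) ≼-refl)

proposition3p40 : (Q : Set) (_≤_ : Q → Q → Set) → IsPreorder _≡_ _≤_
    → ((P : Set) → Dec P)
    → (IsBQO _≤_ ⇔ NoBad _≤_) × (NoBad _≤_ ⇔ NoBadSpare _≤_)
proposition3p40 Q _≤_ isPreorder em =
  mk⇔ (IsBQO⇒NoBad _≤_ em) (NoBadSpare⇒IsBQO _≤_ em ≤-refl ∘ NoBad⇒NoBadSpare _≤_) ,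
  mk⇔ (NoBad⇒NoBadSpare _≤_) (IsBQO⇒NoBad _≤_ em ∘ NoBadSpare⇒IsBQO _≤_ em ≤-refl)
  where open IsPreorder isPreorder using () renaming (refl to ≤-refl)
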